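{- Let $p$ be an optimization term, let $n$ be its normal form, and let $c$ be any canonical form of $p$. Then $\mathrm{cost}(c)\leq\mathrm{cost}(n)$.
   Context: Names: an enumerable set $\mathcal{N}$. Atomic problems: a set $C$ with arity $ar$, including $nil$ with $ar(nil)=0$. Optimization terms: $p,q::=p\parallel q\mid(x)p\mid p\pi\mid A(\tilde x)\mid nil$ ($\pi$ a permutation of $\mathcal{N}$, $|\tilde x|=ar(A)$), restriction binding tighter than $\parallel$. Free names: $fn(p\parallel q)=fn(p)\cup fn(q)$, $fn((x)p)=fn(p)\setminus\{x\}$, $fn(p\pi)=\pi(fn(p))$, $fn(A(\tilde x))=\tilde x$, $fn(nil)=\emptyset$. Structural congruence $\equiv$ is generated by: commutative monoid laws for $\parallel$ with unit $nil$; $(x)(y)p\equiv(y)(x)p$, $(x)nil\equiv nil$; $\alpha$-conversion $(x)p\equiv(y)p[x\mapsto y]$ for $y\notin fn(p)$; scope extension (AX$_{SE}$) $(x)(p\parallel q)\equiv(x)p\parallel q$ for $x\notin fn(q)$; $p\,\mathsf{id}\equiv p$, $(p\pi')\pi\equiv p(\pi\circ\pi')$; permutations distribute over the constructors, $A(x_1,\dots,x_n)\pi\equiv A(\pi(x_1),\dots,\pi(x_n))$, $nil\,\pi\equiv nil$, acting capture-avoidingly under restrictions. The hierarchical congruence is the one generated by all these axioms except AX$_{SE}$. A term is in normal form if it is $(\tilde x)(A_1(\tilde x_1)\parallel\dots\parallel A_n(\tilde x_n))$ with $A_i\in C$ and $\tilde x\subseteq\tilde x_1\cup\dots\cup\tilde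 x_n$; the normal form of $p$ is the (unique up to hierarchical congruence) normal-form term $\equiv$-congruent to $p$. A canonical form of $p$ is a term obtained from $p$ by repeatedly applying AX$_{SE}$ from left to right (rewriting $(x)(p'\parallel q')$ to $(x)p'\parallel q'$ when $x\notin fn(q')$, working modulo the hierarchical congruence) until no more applications are possible; in both forms subterms $(\tilde x)nil$ are removed. Complexity (defined on terms without permutation operators): $\mathrm{cost}(A(\tilde x))=|\tilde x|$, $\mathrm{cost}(nil)=0$, $\mathrm{cost}((x)p)=\mathrm{cost}(p)$, $\mathrm{cost}(p\parallel q)=\max\{\mathrm{cost}(p),\mathrm{cost}(q),|fn(p\parallel q)|\}$. -}

module Defs where

open import Data.Nat using (ℕ; _≟_; _⊔_)
open import Data.Nat.Properties using ()
open import Data.Bool using (Bool; true; false)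
open import Data.List using (List; []; _∷_; _++_; map; filter; length; deduplicate; concatMap)
open import Data.List.Membership.Propositional using (_∈_; _∉_)
open import Data.List.Relation.Unary.All using (All)
open import Data.Vec using (Vec; toList) renaming (map to vmap)
open import Data.Product using (Σ; _,_; proj₁; proj₂; ∃)
open import Data.Empty using (⊥-elim)
open import Function using (_∘_)
open import Function.Bundles using (_↔_; Inverse; mk↔ₛ′)
open import Function.Construct.Identity using (↔-id)
open import Function.Construct.Composition using (_↔-∘_)
open import Relation.Nullary using (yes; no; ¬?)
open import Relation.Binary.PropositionalEquality using (_≡_; refl; sym)
open import Relation.Binary.Construct.Closure.ReflexiveTransitive using (Star)

Name : Set
Name = ℕ

Perm : Set
Perm = ℕ ↔ ℕ

_⟨$⟩_ : Perm → Name → Name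
π ⟨$⟩ x = Inverse.to π x

swapFun : Name → Name → Name → Name
swapFun x y z with z ≟ x
... | yes _ = y
... | no _ with z ≟ y
...   | yes _ = x
...   | no _ = z

swapFun-invol : ∀ x y z → swapFun x y (swapFun x y z) ≡ z
swapFun-invol x y z with z ≟ x
swapFun-invol x y z | yes refl with y ≟ z
... | yes refl = refl
... | no y≢z with y ≟ y
...   | yes _ = refl
...   | no y≢y = ⊥-elim (y≢y refl)
swapFun-invol x y z | no z≢x with z ≟ y
swapFun-invol x y z | no z≢x | yes refl with x ≟ x
... | yes _ = refl
... | no x≢x = ⊥-elim (x≢x refl)
swapFun-invol x y z | no z≢x | no z≢y with z ≟ x
... | yes z≡x = ⊥-elim (z≢x z≡x)
... | no _ with z ≟ y
...   | yes z≡y = ⊥-elim (z≢y z≡y)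
...   | no _ = refl

transposition : Name → Name → Perm
transposition x y = mk↔ₛ′ (swapFun x y) (swapFun x y) (swapFun-invol x y) (swapFun-invol x y)

module Calculus (C : Set) (ar : C → ℕ) where

  infixl 5 _∥_
  data Term : Set where
    _∥_  : Term → Term → Term
    ν    : Name → Term → Term
    _·_  : Term → Perm → Term
    atom : (A : C) → Vec Name (ar A) → Term
    nil  : Term

  -- free names, as a list (possibly with repetitions)
  fn : Term → List Name
  fn (p ∥ q) = fn p ++ fn q
  fn (ν x p) = filter (λ y → ¬? (y ≟ x)) (fn p)
  fn (p · π) = map (π ⟨$⟩_) (fn p)
  fn (atom A xs) = toList xs
  fn nil = []

  card : List Name → ℕ
  card xs = length (deduplicate _≟_ xs)

  -- Structural congruence.  withSE = true : full congruence ≡ ;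
  -- withSE = false : hierarchical congruence (all axioms except AX_SE).
  data Cong (withSE : Bool) : Term → Term → Set where
    ≈refl  : ∀ {p} → Cong withSE p p
    ≈sym   : ∀ {p q} → Cong withSE p q → Cong withSE q p
    ≈trans : ∀ {p q r} → Cong withSE p q → Cong withSE q r → Cong withSE p r
    ∥-cong : ∀ {p p' q q'} → Cong withSE p p' → Cong withSE q q' → Cong withSE (p ∥ q) (p' ∥ q')
    ν-cong : ∀ {x p p'} → Cong withSE p p' → Cong withSE (ν x p) (ν x p')
    ·-cong : ∀ {p p' π} → Cong withSE p p' → Cong withSE (p · π) (p' · π)
    ∥-comm  : ∀ {p q} → Cong withSE (p ∥ q) (q ∥ p)
    ∥-assoc : ∀ {p q r} → Cong withSE ((p ∥ q) ∥ r) (p ∥ (q ∥ r))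
    ∥-unit  : ∀ {p} → Cong withSE (p ∥ nil) p
    ν-comm : ∀ {x y p} → Cong withSE (ν x (ν y p)) (ν y (ν x p))
    ν-nil  : ∀ {x} → Cong withSE (ν x nil) nil
    -- α-conversion: (x)p ≡ (y)p[x↦y] for y ∉ fn(p); the renaming is
    -- performed by the transposition (x y), which agrees with p[x↦y]
    -- (up to α) since y ∉ fn(p)
    α-conv : ∀ {x y p} → y ∉ fn p → Cong withSE (ν x p) (ν y (p · transposition x y))
    ax-SE  : ∀ {x p q} → withSE ≡ true → x ∉ fn q → Cong withSE (ν x (p ∥ q)) (ν x p ∥ q)
    ·-id    : ∀ {p} → Cong withSE (p · ↔-id ℕ) p
    ·-comp  : ∀ {p π π'} → Cong withSE ((p · π') · π) (p · (π ↔-∘ π'))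
    ·-ext   : ∀ {p π π'} → (∀ z → π ⟨$⟩ z ≡ π' ⟨$⟩ z) → Cong withSE (p · π) (p · π')
    ·-∥     : ∀ {p q π} → Cong withSE ((p ∥ q) · π) ((p · π) ∥ (q · π))
    ·-ν     : ∀ {x p π} → Cong withSE ((ν x p) · π) (ν (π ⟨$⟩ x) (p · π))
    ·-atom  : ∀ {A xs π} → Cong withSE ((atom A xs) · π) (atom A (vmap (π ⟨$⟩_) xs))
    ·-nil   : ∀ {π} → Cong withSE (nil · π) nil

  _≅_ : Term → Term → Set
  _≅_ = Cong true

  _≅ʰ_ : Term → Term → Set
  _≅ʰ_ = Cong false

  data SEStep : Term → Term → Set where
    se-top : ∀ {x p q} → x ∉ fn q → SEStep (ν x (p ∥ q)) (ν x p ∥ q)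
    se-∥ˡ  : ∀ {p p' q} → SEStep p p' → SEStep (p ∥ q) (p' ∥ q)
    se-∥ʳ  : ∀ {p q q'} → SEStep q q' → SEStep (p ∥ q) (p ∥ q')
    se-ν   : ∀ {x p p'} → SEStep p p' → SEStep (ν x p) (ν x p')
    se-·   : ∀ {p p' π} → SEStep p p' → SEStep (p · π) (p' · π)

  Step : Term → Term → Set
  Step t t' = Σ Term λ u → Σ Term λ u' → t ≅ʰ u × SEStep u u' × u' ≅ʰ t'
    where open import Data.Product using (_×_)

  -- no further (effective) application is possible: every AX_SE step
  -- from t stays in the hierarchical-congruence class of t
  Irreducible : Term → Set
  Irreducible t = ∀ t' → Step t t' → t ≅ʰ t'

  CanonicalForm : Term → Term → Set
  CanonicalForm p c = Star Step p c × Irreducible c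
    where open import Data.Product using (_×_)

  data PermFree : Term → Set where
    pf-∥    : ∀ {p q} → PermFree p → PermFree q → PermFree (p ∥ q)
    pf-ν    : ∀ {x p} → PermFree p → PermFree (ν x p)
    pf-atom : ∀ {A xs} → PermFree (atom A xs)
    pf-nil  : PermFree nil

  -- normal-form terms (x̃)(A₁(x̃₁) ∥ … ∥ Aₙ(x̃ₙ))
  Atom : Set
  Atom = Σ C (λ A → Vec Name (ar A))

  atomTerm : Atom → Term
  atomTerm (A , xs) = atom A xs

  parAll : List Atom → Term
  parAll [] = nil
  parAll (a ∷ []) = atomTerm a
  parAll (a ∷ b ∷ as) = atomTerm a ∥ parAll (b ∷ as)

  resAll : List Name → Term → Term
  resAll [] p = p
  resAll (x ∷ xs) p = ν x (resAll xs p)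

  atomNames : List Atom → List Name
  atomNames = concatMap (λ a → toList (proj₂ a))

  data IsNormalFormTerm : Term → Set where
    nf : (xs : List Name) (as : List Atom) →
         All (_∈ atomNames as) xs →
         IsNormalFormTerm (resAll xs (parAll as))

  NormalFormOf : Term → Term → Set
  NormalFormOf p n = IsNormalFormTerm n × (n ≅ p)
    where open import Data.Product using (_×_)

  -- complexity (on permutation-free terms; the · clause is never used
  -- in the statement, which requires PermFree)
  cost : Term → ℕ
  cost (atom A xs) = ar A
  cost nil = 0
  cost (ν x p) = cost p
  cost (p ∥ q) = cost p ⊔ cost q ⊔ card (fn (p ∥ q))
  cost (p · π) = cost p

-- Three quantities are invariant under structural congruence, scope
-- extension included: the largest arity of an atom, the set of free names,
-- and the number of live restrictions (x)p, those with x free in p.  Every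
-- parallel composition in a permutation-free term only involves names that
-- are free or bound by a live restriction above it, so its cost is at most
-- maxArity ⊔ (#free names + #live restrictions); in a normal form all
-- restrictions are live and sit above one flat composition, where this bound
-- is attained.  So the inequality holds for every permutation-free term
-- congruent to p.
module Submission where

open import Defs
open import Data.Nat using (ℕ; suc; _+_; _⊔_; _≤_; z≤n; s≤s; _≟_)
open import Data.Nat.Properties
open import Algebra.Properties.CommutativeSemigroup +-commutativeSemigroup using (x∙yz≈y∙xz; x∙yz≈yx∙z)
open import Data.List using (List; []; _∷_; _++_; map; filter; length; deduplicate)
open import Data.List.Properties
  using (filter-all; filter-notAll; filter-accept; filter-reject; filter-++; map-∘; map-cong; map-id; map-id-local; map-++; ++-assoc; ++-identityʳ)
open import Data.List.Membership.Propositional using (_∈_; _∉_)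
open import Data.List.Membership.Propositional.Properties using (∈-map⁺; ∈-map⁻; ∈-++⁻; ∈-filter⁺; ∈-filter⁻; ∈-deduplicate⁺; ∈-deduplicate⁻)
open import Data.List.Membership.DecPropositional _≟_ using (_∈?_)
open import Data.List.Relation.Binary.Subset.Propositional using (_⊆_)
open import Data.List.Relation.Binary.Subset.Propositional.Properties
  using (⊆-reflexive; ⊆-reflexive-↭; ++⁺; map⁺; xs⊆xs++ys; xs⊆ys++xs; ∈-∷⁺ʳ; filter-⊆)
open import Data.List.Relation.Binary.Permutation.Propositional.Properties using (++-comm)
open import Data.List.Relation.Unary.Any using (here; there)
import Data.List.Relation.Unary.Any as Any
import Data.List.Relation.Unary.All as All
open import Data.List.Relation.Unary.Unique.Propositional using (Unique)
open import Data.List.Relation.Unary.AllPairs using (_∷_)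
open import Data.List.Relation.Unary.Unique.DecPropositional.Properties _≟_ using (deduplicate-!)
open import Data.Vec using (toList)
open import Data.Vec.Properties using (toList-map; length-toList)
open import Data.Product using (_,_; proj₁; proj₂)
open import Data.Sum using (inj₁; inj₂)
open import Function using (_∘_)
open import Function.Bundles using (Injection)
open import Function.Properties.Inverse using (↔⇒↣)
open import Function.Definitions using (Injective)
open import Relation.Nullary using (yes; no; ¬?; contradiction)
open import Relation.Binary.PropositionalEquality
open import Relation.Unary using (Decidable)
open import Relation.Binary.Construct.Closure.ReflexiveTransitive using (Star; fold)

≢? : (x : Name) → Decidable (_≢ x)
≢? x y = ¬? (y ≟ x)

without : Name → List Name → List Name
without x = filter (≢? x)

-- Calculus.card without the module parameters; the two are definitionally equal.
card : List Name → ℕ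
card xs = length (deduplicate _≟_ xs)

occurs : Name → List Name → ℕ
occurs x xs with x ∈? xs
... | yes _ = 1
... | no _ = 0

occurs-∈ : ∀ {x xs} → x ∈ xs → occurs x xs ≡ 1
occurs-∈ {x} {xs} x∈xs with x ∈? xs
... | yes _ = refl
... | no x∉xs = contradiction x∈xs x∉xs

occurs-∉ : ∀ {x xs} → x ∉ xs → occurs x xs ≡ 0
occurs-∉ {x} {xs} x∉xs with x ∈? xs
... | yes x∈xs = contradiction x∈xs x∉xs
... | no _ = refl

occurs-cong : ∀ {x xs y ys} → (x ∈ xs → y ∈ ys) → (y ∈ ys → x ∈ xs) → occurs x xs ≡ occurs y ys
occurs-cong {x} {xs} to from with x ∈? xs
... | yes x∈xs = sym (occurs-∈ (to x∈xs))
... | no x∉xs = sym (occurs-∉ (x∉xs ∘ from))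

occurs-map : ∀ {f : Name → Name} → Injective _≡_ _≡_ f → ∀ x xs → occurs (f x) (map f xs) ≡ occurs x xs
occurs-map {f} f-inj x xs = occurs-cong from (∈-map⁺ f)
  where
  from : f x ∈ map f xs → x ∈ xs
  from fx∈ with ∈-map⁻ f fx∈
  ... | z , z∈xs , fx≡fz = subst (_∈ xs) (sym (f-inj fx≡fz)) z∈xs

occurs-without : ∀ {x y} → x ≢ y → ∀ xs → occurs x (without y xs) ≡ occurs x xs
occurs-without x≢y xs = occurs-cong (proj₁ ∘ ∈-filter⁻ (≢? _) {xs = xs}) (λ x∈xs → ∈-filter⁺ (≢? _) x∈xs x≢y)

without-comm : ∀ x y xs → without x (without y xs) ⊆ without y (without x xs)
without-comm x y xs z∈ with ∈-filter⁻ (≢? x) {xs = without y xs} z∈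
... | z∈′ , z≢x with ∈-filter⁻ (≢? y) {xs = xs} z∈′
... | z∈xs , z≢y = ∈-filter⁺ (≢? y) (∈-filter⁺ (≢? x) z∈xs z≢x) z≢y

without-⊆ : ∀ x {xs ys} → xs ⊆ ys → without x xs ⊆ without x ys
without-⊆ x xs⊆ys z∈ with ∈-filter⁻ (≢? x) z∈
... | z∈xs , z≢x = ∈-filter⁺ (≢? x) (xs⊆ys z∈xs) z≢x

without-++-fresh : ∀ {x} xs {ys} → x ∉ ys → without x (xs ++ ys) ≡ without x xs ++ ys
without-++-fresh {x} xs {ys} x∉ys = begin
  without x (xs ++ ys)           ≡⟨ filter-++ (≢? x) xs ys ⟩
  without x xs ++ without x ys   ≡⟨ cong (without x xs ++_) (filter-all (≢? x) (All.tabulate λ { z∈ refl → x∉ys z∈ })) ⟩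
  without x xs ++ ys             ∎
  where open ≡-Reasoning

map-without : ∀ {f : Name → Name} → Injective _≡_ _≡_ f → ∀ x xs → map f (without x xs) ≡ without (f x) (map f xs)
map-without f-inj x [] = refl
map-without {f} f-inj x (y ∷ xs) with y ≟ x
... | yes refl = begin
  map f (without y (y ∷ xs))         ≡⟨ cong (map f) (filter-reject (≢? y) (λ y≢y → y≢y refl)) ⟩
  map f (without y xs)               ≡⟨ map-without f-inj y xs ⟩
  without (f y) (map f xs)           ≡⟨ filter-reject (≢? (f y)) (λ fy≢fy → fy≢fy refl) ⟨
  without (f y) (map f (y ∷ xs))     ∎
  where open ≡-Reasoning
... | no y≢x = begin
  map f (without x (y ∷ xs))         ≡⟨ cong (map f) (filter-accept (≢? x) y≢x) ⟩
  f y ∷ map f (without x xs)         ≡⟨ cong (f y ∷_) (map-without f-inj x xs) ⟩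
  f y ∷ without (f x) (map f xs)     ≡⟨ filter-accept (≢? (f x)) (y≢x ∘ f-inj) ⟨
  without (f x) (map f (y ∷ xs))     ∎
  where open ≡-Reasoning

Unique-length-mono : ∀ {xs ys : List Name} → Unique xs → xs ⊆ ys → length xs ≤ length ys
Unique-length-mono {[]} _ _ = z≤n
Unique-length-mono {x ∷ xs} {ys} (x∉xs ∷ xs!) x∷xs⊆ys = begin
  suc (length xs)             ≤⟨ s≤s (Unique-length-mono xs! xs⊆ys∖x) ⟩
  suc (length (without x ys)) ≤⟨ filter-notAll (≢? x) ys (Any.map (λ x≡y y≢x → y≢x (sym x≡y)) (x∷xs⊆ys (here refl))) ⟩
  length ys                   ∎
  where
  open ≤-Reasoning
  xs⊆ys∖x : xs ⊆ without x ys
  xs⊆ys∖x z∈xs = ∈-filter⁺ (≢? x) (x∷xs⊆ys (there z∈xs)) (λ z≡x → All.lookup x∉xs z∈xs (sym z≡x))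

card-mono : ∀ {xs ys} → xs ⊆ ys → card xs ≤ card ys
card-mono {xs} xs⊆ys = Unique-length-mono (deduplicate-! xs) (∈-deduplicate⁺ _≟_ ∘ xs⊆ys ∘ ∈-deduplicate⁻ _≟_ xs)

card-cong : ∀ {xs ys} → xs ⊆ ys → ys ⊆ xs → card xs ≡ card ys
card-cong xs⊆ys ys⊆xs = ≤-antisym (card-mono xs⊆ys) (card-mono ys⊆xs)

card≤length : ∀ xs → card xs ≤ length xs
card≤length xs = Unique-length-mono (deduplicate-! xs) (∈-deduplicate⁻ _≟_ xs)

card-∷-fresh : ∀ {x xs} → x ∉ xs → card (x ∷ xs) ≡ suc (card xs)
card-∷-fresh {x} {xs} x∉xs =
  cong (suc ∘ length) (filter-all (¬? ∘ (x ≟_)) (All.tabulate λ z∈ x≡z → x∉xs (subst (_∈ xs) (sym x≡z) (∈-deduplicate⁻ _≟_ xs z∈))))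

card-without : ∀ x xs → card xs ≡ occurs x xs + card (without x xs)
card-without x xs with x ∈? xs
... | no x∉xs =
  sym (cong card (filter-all (≢? x) (All.tabulate λ { z∈ refl → x∉xs z∈ })))
... | yes x∈xs = begin
  card xs                            ≡⟨ card-cong xs⊆x∷xs∖x (∈-∷⁺ʳ x∈xs (filter-⊆ (≢? x) xs)) ⟩
  card (x ∷ without x xs)            ≡⟨ card-∷-fresh (λ x∈ → proj₂ (∈-filter⁻ (≢? x) {xs = xs} x∈) refl) ⟩
  suc (card (without x xs))          ∎
  where
  open ≡-Reasoning
  xs⊆x∷xs∖x : xs ⊆ x ∷ without x xs
  xs⊆x∷xs∖x {z} z∈xs with z ≟ x
  ... | yes refl = here refl
  ... | no z≢x = there (∈-filter⁺ (≢? x) z∈xs z≢x)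

perm-injective : (π : Perm) → Injective _≡_ _≡_ (π ⟨$⟩_)
perm-injective π = Injection.injective (↔⇒↣ π)

swap-left : ∀ x y → transposition x y ⟨$⟩ x ≡ y
swap-left x y with x ≟ x
... | yes _ = refl
... | no x≢x = contradiction refl x≢x

swap-fixes : ∀ {x y z} → z ≢ x → z ≢ y → transposition x y ⟨$⟩ z ≡ z
swap-fixes {x} {y} {z} z≢x z≢y with z ≟ x
... | yes z≡x = contradiction z≡x z≢x
... | no _ with z ≟ y
...   | yes z≡y = contradiction z≡y z≢y
...   | no _ = refl

module Invariants (C : Set) (ar : C → ℕ) where
  open Calculus C ar hiding (card)

  maxArity : Term → ℕ
  maxArity (p ∥ q) = maxArity p ⊔ maxArity q
  maxArity (ν x p) = maxArity p
  maxArity (p · π) = maxArity p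
  maxArity (atom A xs) = ar A
  maxArity nil = 0

  liveRestrictions : Term → ℕ
  liveRestrictions (p ∥ q) = liveRestrictions p + liveRestrictions q
  liveRestrictions (ν x p) = occurs x (fn p) + liveRestrictions p
  liveRestrictions (p · π) = liveRestrictions p
  liveRestrictions (atom A xs) = 0
  liveRestrictions nil = 0

  names : Term → ℕ
  names t = card (fn t) + liveRestrictions t

  costBound : Term → ℕ
  costBound t = maxArity t ⊔ names t

  record _∼_ (t u : Term) : Set where
    field
      maxArity-≡ : maxArity t ≡ maxArity u
      liveRestrictions-≡ : liveRestrictions t ≡ liveRestrictions u
      fn-⊆ : fn t ⊆ fn u
      fn-⊇ : fn u ⊆ fn t
  open _∼_

  ∼-refl : ∀ {t} → t ∼ t
  ∼-refl = record { maxArity-≡ = refl ; liveRestrictions-≡ = refl ; fn-⊆ = λ z∈ → z∈ ; fn-⊇ = λ z∈ → z∈ }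

  ∼-sym : ∀ {t u} → t ∼ u → u ∼ t
  ∼-sym t∼u = record
    { maxArity-≡ = sym (maxArity-≡ t∼u) ; liveRestrictions-≡ = sym (liveRestrictions-≡ t∼u)
    ; fn-⊆ = fn-⊇ t∼u ; fn-⊇ = fn-⊆ t∼u }

  ∼-trans : ∀ {t u v} → t ∼ u → u ∼ v → t ∼ v
  ∼-trans t∼u u∼v = record
    { maxArity-≡ = trans (maxArity-≡ t∼u) (maxArity-≡ u∼v)
    ; liveRestrictions-≡ = trans (liveRestrictions-≡ t∼u) (liveRestrictions-≡ u∼v)
    ; fn-⊆ = fn-⊆ u∼v ∘ fn-⊆ t∼u ; fn-⊇ = fn-⊇ t∼u ∘ fn-⊇ u∼v }

  ∼-with-fn-≡ : ∀ {t u} → maxArity t ≡ maxArity u → liveRestrictions t ≡ liveRestrictions u → fn t ≡ fn u → t ∼ u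
  ∼-with-fn-≡ m≡ l≡ fn≡ = record
    { maxArity-≡ = m≡ ; liveRestrictions-≡ = l≡ ; fn-⊆ = ⊆-reflexive fn≡ ; fn-⊇ = ⊆-reflexive (sym fn≡) }

  ∼⇒costBound-≡ : ∀ {t u} → t ∼ u → costBound t ≡ costBound u
  ∼⇒costBound-≡ t∼u =
    cong₂ _⊔_ (maxArity-≡ t∼u) (cong₂ _+_ (card-cong (fn-⊆ t∼u) (fn-⊇ t∼u)) (liveRestrictions-≡ t∼u))

  ∥-∼ : ∀ {p p′ q q′} → p ∼ p′ → q ∼ q′ → (p ∥ q) ∼ (p′ ∥ q′)
  ∥-∼ p∼ q∼ = record
    { maxArity-≡ = cong₂ _⊔_ (maxArity-≡ p∼) (maxArity-≡ q∼)
    ; liveRestrictions-≡ = cong₂ _+_ (liveRestrictions-≡ p∼) (liveRestrictions-≡ q∼)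
    ; fn-⊆ = ++⁺ (fn-⊆ p∼) (fn-⊆ q∼) ; fn-⊇ = ++⁺ (fn-⊇ p∼) (fn-⊇ q∼) }

  ν-∼ : ∀ x {p p′} → p ∼ p′ → ν x p ∼ ν x p′
  ν-∼ x p∼ = record
    { maxArity-≡ = maxArity-≡ p∼
    ; liveRestrictions-≡ = cong₂ _+_ (occurs-cong (fn-⊆ p∼) (fn-⊇ p∼)) (liveRestrictions-≡ p∼)
    ; fn-⊆ = without-⊆ x (fn-⊆ p∼) ; fn-⊇ = without-⊆ x (fn-⊇ p∼) }

  ·-∼ : ∀ π {p p′} → p ∼ p′ → (p · π) ∼ (p′ · π)
  ·-∼ π p∼ = record
    { maxArity-≡ = maxArity-≡ p∼ ; liveRestrictions-≡ = liveRestrictions-≡ p∼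
    ; fn-⊆ = map⁺ (π ⟨$⟩_) (fn-⊆ p∼) ; fn-⊇ = map⁺ (π ⟨$⟩_) (fn-⊇ p∼) }

  ∥-comm-∼ : ∀ p q → (p ∥ q) ∼ (q ∥ p)
  ∥-comm-∼ p q = record
    { maxArity-≡ = ⊔-comm (maxArity p) (maxArity q)
    ; liveRestrictions-≡ = +-comm (liveRestrictions p) (liveRestrictions q)
    ; fn-⊆ = ⊆-reflexive-↭ (++-comm (fn p) (fn q)) ; fn-⊇ = ⊆-reflexive-↭ (++-comm (fn q) (fn p)) }

  ν-comm-∼ : ∀ x y p → ν x (ν y p) ∼ ν y (ν x p)
  ν-comm-∼ x y p with x ≟ y
  ... | yes refl = ∼-refl
  ... | no x≢y = record
    { maxArity-≡ = refl ; liveRestrictions-≡ = live-≡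
    ; fn-⊆ = without-comm x y (fn p) ; fn-⊇ = without-comm y x (fn p) }
    where
    open ≡-Reasoning
    live-≡ : occurs x (without y (fn p)) + (occurs y (fn p) + liveRestrictions p)
           ≡ occurs y (without x (fn p)) + (occurs x (fn p) + liveRestrictions p)
    live-≡ = begin
      occurs x (without y (fn p)) + (occurs y (fn p) + liveRestrictions p)
        ≡⟨ cong (_+ _) (occurs-without x≢y (fn p)) ⟩
      occurs x (fn p) + (occurs y (fn p) + liveRestrictions p)
        ≡⟨ x∙yz≈y∙xz (occurs x (fn p)) (occurs y (fn p)) (liveRestrictions p) ⟩
      occurs y (fn p) + (occurs x (fn p) + liveRestrictions p)
        ≡⟨ cong (_+ _) (occurs-without (x≢y ∘ sym) (fn p)) ⟨
      occurs y (without x (fn p)) + (occurs x (fn p) + liveRestrictions p) ∎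

  ax-SE-∼ : ∀ {x p q} → x ∉ fn q → ν x (p ∥ q) ∼ (ν x p ∥ q)
  ax-SE-∼ {x} {p} {q} x∉q = ∼-with-fn-≡ refl live-≡ (without-++-fresh (fn p) x∉q)
    where
    x∈p : x ∈ fn p ++ fn q → x ∈ fn p
    x∈p x∈ with ∈-++⁻ (fn p) x∈
    ... | inj₁ x∈p = x∈p
    ... | inj₂ x∈q = contradiction x∈q x∉q
    live-≡ : occurs x (fn p ++ fn q) + (liveRestrictions p + liveRestrictions q)
           ≡ occurs x (fn p) + liveRestrictions p + liveRestrictions q
    live-≡ = trans (cong (_+ _) (occurs-cong x∈p (xs⊆xs++ys (fn p) (fn q))))
                   (sym (+-assoc (occurs x (fn p)) (liveRestrictions p) (liveRestrictions q)))

  ·-ν-∼ : ∀ {x p π} → (ν x p · π) ∼ ν (π ⟨$⟩ x) (p · π)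
  ·-ν-∼ {x} {p} {π} =
    ∼-with-fn-≡ refl (cong (_+ _) (sym (occurs-map (perm-injective π) x (fn p))))
                     (map-without (perm-injective π) x (fn p))

  ·-fixing-∼ : ∀ {p π} → (∀ {z} → z ∈ fn p → π ⟨$⟩ z ≡ z) → (p · π) ∼ p
  ·-fixing-∼ fixes = ∼-with-fn-≡ refl refl (map-id-local (All.tabulate fixes))

  -- (x)p ≡ ((x)p)τ ≡ (y)(pτ) for the transposition τ = (x y), which fixes fn((x)p) as y ∉ fn(p).
  α-conv-∼ : ∀ {x y p} → y ∉ fn p → ν x p ∼ ν y (p · transposition x y)
  α-conv-∼ {x} {y} {p} y∉p =
    ∼-trans (∼-sym (·-fixing-∼ τ-fixes))
            (subst (λ z → (ν x p · transposition x y) ∼ ν z (p · transposition x y)) (swap-left x y) ·-ν-∼)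
    where
    τ-fixes : ∀ {z} → z ∈ fn (ν x p) → transposition x y ⟨$⟩ z ≡ z
    τ-fixes z∈ with ∈-filter⁻ (≢? x) {xs = fn p} z∈
    ... | z∈p , z≢x = swap-fixes z≢x (λ { refl → y∉p z∈p })

  Cong⇒∼ : ∀ {b t u} → Cong b t u → t ∼ u
  Cong⇒∼ ≈refl = ∼-refl
  Cong⇒∼ (≈sym h) = ∼-sym (Cong⇒∼ h)
  Cong⇒∼ (≈trans h k) = ∼-trans (Cong⇒∼ h) (Cong⇒∼ k)
  Cong⇒∼ (∥-cong h k) = ∥-∼ (Cong⇒∼ h) (Cong⇒∼ k)
  Cong⇒∼ (ν-cong {x} h) = ν-∼ x (Cong⇒∼ h)
  Cong⇒∼ (·-cong {π = π} h) = ·-∼ π (Cong⇒∼ h)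
  Cong⇒∼ (∥-comm {p} {q}) = ∥-comm-∼ p q
  Cong⇒∼ (∥-assoc {p} {q} {r}) =
    ∼-with-fn-≡ (⊔-assoc (maxArity p) _ _) (+-assoc (liveRestrictions p) _ _) (++-assoc (fn p) _ _)
  Cong⇒∼ (∥-unit {p}) = ∼-with-fn-≡ (⊔-identityʳ _) (+-identityʳ _) (++-identityʳ (fn p))
  Cong⇒∼ (ν-comm {x} {y} {p}) = ν-comm-∼ x y p
  Cong⇒∼ ν-nil = ∼-with-fn-≡ refl refl refl
  Cong⇒∼ (α-conv y∉p) = α-conv-∼ y∉p
  Cong⇒∼ (ax-SE _ x∉q) = ax-SE-∼ x∉q
  Cong⇒∼ (·-id {p}) = ∼-with-fn-≡ refl refl (map-id (fn p))
  Cong⇒∼ (·-comp {p}) = ∼-with-fn-≡ refl refl (sym (map-∘ (fn p)))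
  Cong⇒∼ (·-ext {p} π≗π′) = ∼-with-fn-≡ refl refl (map-cong π≗π′ (fn p))
  Cong⇒∼ (·-∥ {p} {q} {π}) = ∼-with-fn-≡ refl refl (map-++ (π ⟨$⟩_) (fn p) (fn q))
  Cong⇒∼ ·-ν = ·-ν-∼
  Cong⇒∼ (·-atom {xs = xs} {π}) = ∼-with-fn-≡ refl refl (sym (toList-map (π ⟨$⟩_) xs))
  Cong⇒∼ ·-nil = ∼-with-fn-≡ refl refl refl

  SEStep⇒≅ : ∀ {t u} → SEStep t u → t ≅ u
  SEStep⇒≅ (se-top x∉q) = ax-SE refl x∉q
  SEStep⇒≅ (se-∥ˡ s) = ∥-cong (SEStep⇒≅ s) ≈refl
  SEStep⇒≅ (se-∥ʳ s) = ∥-cong ≈refl (SEStep⇒≅ s)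
  SEStep⇒≅ (se-ν s) = ν-cong (SEStep⇒≅ s)
  SEStep⇒≅ (se-· s) = ·-cong (SEStep⇒≅ s)

  Step⇒∼ : ∀ {t u} → Step t u → t ∼ u
  Step⇒∼ (_ , _ , t≅ʰ , s , ≅ʰu) = ∼-trans (Cong⇒∼ t≅ʰ) (∼-trans (Cong⇒∼ (SEStep⇒≅ s)) (Cong⇒∼ ≅ʰu))

  Steps⇒∼ : ∀ {t u} → Star Step t u → t ∼ u
  Steps⇒∼ = fold _∼_ (λ s t∼u → ∼-trans (Step⇒∼ s) t∼u) ∼-refl

  names-ν : ∀ x p → names (ν x p) ≡ names p
  names-ν x p = begin
    card (without x (fn p)) + (occurs x (fn p) + liveRestrictions p)
      ≡⟨ x∙yz≈yx∙z (card (without x (fn p))) (occurs x (fn p)) (liveRestrictions p) ⟩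
    occurs x (fn p) + card (without x (fn p)) + liveRestrictions p
      ≡⟨ cong (_+ liveRestrictions p) (card-without x (fn p)) ⟨
    card (fn p) + liveRestrictions p ∎
    where open ≡-Reasoning

  costBound-∥ˡ : ∀ p q → costBound p ≤ costBound (p ∥ q)
  costBound-∥ˡ p q = ⊔-mono-≤ (m≤m⊔n (maxArity p) (maxArity q))
    (+-mono-≤ (card-mono (xs⊆xs++ys (fn p) (fn q))) (m≤m+n (liveRestrictions p) (liveRestrictions q)))

  costBound-∥ʳ : ∀ p q → costBound q ≤ costBound (p ∥ q)
  costBound-∥ʳ p q = ⊔-mono-≤ (m≤n⊔m (maxArity p) (maxArity q))
    (+-mono-≤ (card-mono (xs⊆ys++xs (fn q) (fn p))) (m≤n+m (liveRestrictions q) (liveRestrictions p)))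

  cost≤costBound : ∀ {t} → PermFree t → cost t ≤ costBound t
  cost≤costBound (pf-∥ {p} {q} p-pf q-pf) =
    ⊔-lub (⊔-lub (≤-trans (cost≤costBound p-pf) (costBound-∥ˡ p q))
                 (≤-trans (cost≤costBound q-pf) (costBound-∥ʳ p q)))
          (≤-trans (m≤m+n _ _) (m≤n⊔m _ _))
  cost≤costBound (pf-ν {x} {p} p-pf) = ≤-trans (cost≤costBound p-pf) (≤-reflexive (cong (maxArity p ⊔_) (sym (names-ν x p))))
  cost≤costBound (pf-atom {A}) = m≤m⊔n (ar A) _
  cost≤costBound pf-nil = z≤n

  costBound-resAll : ∀ xs t → costBound (resAll xs t) ≡ costBound t
  costBound-resAll [] t = refl
  costBound-resAll (x ∷ xs) t = trans (cong (maxArity (resAll xs t) ⊔_) (names-ν x (resAll xs t))) (costBound-resAll xs t)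

  cost-resAll : ∀ xs t → cost (resAll xs t) ≡ cost t
  cost-resAll [] t = refl
  cost-resAll (x ∷ xs) t = cost-resAll xs t

  liveRestrictions-parAll : ∀ as → liveRestrictions (parAll as) ≡ 0
  liveRestrictions-parAll [] = refl
  liveRestrictions-parAll (a ∷ []) = refl
  liveRestrictions-parAll (a ∷ b ∷ as) = liveRestrictions-parAll (b ∷ as)

  maxArity⊔card≤cost-parAll : ∀ as → maxArity (parAll as) ⊔ card (fn (parAll as)) ≤ cost (parAll as)
  maxArity⊔card≤cost-parAll [] = z≤n
  maxArity⊔card≤cost-parAll ((A , xs) ∷ []) =
    ⊔-lub ≤-refl (≤-trans (card≤length (toList xs)) (≤-reflexive (length-toList xs)))
  maxArity⊔card≤cost-parAll ((A , xs) ∷ b ∷ as) =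
    ⊔-monoˡ-≤ _ (⊔-monoʳ-≤ (ar A) (≤-trans (m≤m⊔n _ _) (maxArity⊔card≤cost-parAll (b ∷ as))))

  costBound≤cost-normalForm : ∀ {n} → IsNormalFormTerm n → costBound n ≤ cost n
  costBound≤cost-normalForm (nf xs as _) = begin
    costBound (resAll xs P)                                 ≡⟨ costBound-resAll xs P ⟩
    maxArity P ⊔ (card (fn P) + liveRestrictions P)         ≡⟨ cong (λ k → maxArity P ⊔ (card (fn P) + k)) (liveRestrictions-parAll as) ⟩
    maxArity P ⊔ (card (fn P) + 0)                          ≡⟨ cong (maxArity P ⊔_) (+-identityʳ _) ⟩
    maxArity P ⊔ card (fn P)                                ≤⟨ maxArity⊔card≤cost-parAll as ⟩
    cost P                                                  ≡⟨ cost-resAll xs P ⟨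
    cost (resAll xs P)                                      ∎
    where
    open ≤-Reasoning
    P = parAll as

  cost≤cost-normalForm : ∀ {c n} → PermFree c → c ∼ n → IsNormalFormTerm n → cost c ≤ cost n
  cost≤cost-normalForm {c} {n} c-pf c∼n n-nf = begin
    cost c       ≤⟨ cost≤costBound c-pf ⟩
    costBound c  ≡⟨ ∼⇒costBound-≡ c∼n ⟩
    costBound n  ≤⟨ costBound≤cost-normalForm n-nf ⟩
    cost n       ∎
    where open ≤-Reasoning

theorem2 : (C : Set) (ar : C → ℕ) →
    let open Calculus C ar in
    (p n c : Term) → NormalFormOf p n → CanonicalForm p c → PermFree c →
    cost c ≤ cost n
theorem2 C ar p n c (n-nf , n≅p) (p→*c , _) c-pf =
  cost≤cost-normalForm c-pf (∼-sym (∼-trans (Cong⇒∼ n≅p) (Steps⇒∼ p→*c))) n-nf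
  where open Invariants C ar
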